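{- Let $n_1,n_2,n_3,k\in\mathbb{N}$. If $k\ge 3$, then $P_{n_1}\square P_{n_2}\square P_{n_3}$ is equitably $k$-list arborable.
   Context: $\mathbb{N}$ is the set of positive integers. $P_n$ denotes the path on $n$ vertices and $\square$ the Cartesian product. A $k$-uniform list assignment $L$ for $G$ assigns to each vertex $v$ a set $L(v)$ of exactly $k$ colours; an $L$-colouring is a map $c$ with $c(v)\in L(v)$; it is equitable if every colour class has at most $\lceil |V(G)|/k\rceil$ vertices. $G$ is equitably $k$-list arborable if for every $k$-uniform list assignment $L$ there is an equitable $L$-colouring of $G$ in which every colour class induces an acyclic subgraph. -}

module Defs where

open import Level using (0ℓ)
open import Data.Nat using (ℕ; zero; suc; _+_; _*_; _≤_; _/_)
open import Data.Nat.Properties using (_≟_)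
open import Data.Fin using (Fin; toℕ)
open import Data.Product using (_×_; _,_; Σ; ∃; ∃-syntax)
open import Data.Sum using (_⊎_)
open import Data.List using (List; []; _∷_; _++_; [_]; length; filter; allFin; cartesianProduct)
open import Data.List.Membership.Propositional using (_∈_)
open import Data.List.Relation.Unary.Linked using (Linked)
open import Data.List.Relation.Unary.Unique.Propositional using (Unique)
open import Relation.Binary.PropositionalEquality using (_≡_)
open import Relation.Nullary using (¬_)

Graph : Set₁
Graph = Σ Set (λ V → V → V → Set)

Vtx : Graph → Set
Vtx (V , _) = V

Adj : (G : Graph) → Vtx G → Vtx G → Set
Adj (_ , E) = E

P : ℕ → Graph
P n = Fin n , (λ i j → (toℕ j ≡ suc (toℕ i)) ⊎ (toℕ i ≡ suc (toℕ j)))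

_□_ : Graph → Graph → Graph
(V , E) □ (W , F) = (V × W) , (λ { (v , w) (v′ , w′) → (E v v′ × w ≡ w′) ⊎ (v ≡ v′ × F w w′) })

infixl 6 _□_

Grid : ℕ → ℕ → ℕ → Graph
Grid n₁ n₂ n₃ = P n₁ □ P n₂ □ P n₃

gridVertices : (n₁ n₂ n₃ : ℕ) → List (Vtx (Grid n₁ n₂ n₃))
gridVertices n₁ n₂ n₃ = cartesianProduct (cartesianProduct (allFin n₁) (allFin n₂)) (allFin n₃)

-- ⌈ n / k ⌉ (with the irrelevant convention ⌈ n / 0 ⌉ = 0).
⌈_/_⌉ : ℕ → ℕ → ℕ
⌈ n / zero ⌉ = 0
⌈ n / suc k ⌉ = (n + k) / suc k

IsUniformListAssignment : {V : Set} → ℕ → (V → List ℕ) → Set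
IsUniformListAssignment {V} k L = (v : V) → Unique (L v) × length (L v) ≡ k

-- A cycle in graph G all of whose vertices satisfy S (i.e. a cycle of the
-- subgraph induced by S): distinct vertices v, w₁, …, w_m (m ≥ 2, so length ≥ 3)
-- with consecutive ones adjacent and the last adjacent to v.
InducedCycle : (G : Graph) → (Vtx G → Set) → Set
InducedCycle G S =
  ∃[ v ] ∃[ ws ] (2 ≤ length ws × Unique (v ∷ ws)
                 × Linked (Adj G) (v ∷ ws ++ [ v ])
                 × S v × (∀ {u} → u ∈ ws → S u))

classSize : (n₁ n₂ n₃ : ℕ) → (Vtx (Grid n₁ n₂ n₃) → ℕ) → ℕ → ℕ
classSize n₁ n₂ n₃ c a = length (filter (λ v → c v ≟ a) (gridVertices n₁ n₂ n₃))

EquitablyListArborableGrid : ℕ → ℕ → ℕ → ℕ → Set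
EquitablyListArborableGrid n₁ n₂ n₃ k =
  (L : Vtx (Grid n₁ n₂ n₃) → List ℕ) → IsUniformListAssignment k L →
  ∃[ c ] ( ((v : Vtx (Grid n₁ n₂ n₃)) → c v ∈ L v)
         × ((a : ℕ) → classSize n₁ n₂ n₃ c a ≤ ⌈ n₁ * n₂ * n₃ / k ⌉)
         × ((a : ℕ) → ¬ InducedCycle (Grid n₁ n₂ n₃) (λ v → c v ≡ a)) )

-- Order the vertices lexicographically and cut the order into ⌈ N / k ⌉ blocks of k
-- consecutive vertices.  We colour greedily from the lists so that
--   (1) the vertices of one block get distinct colours, and
--   (2) no vertex has two neighbours in lower blocks sharing its colour.
-- By (1) a colour class has at most one vertex per block, which is the equitability
-- bound; by (1) and (2) every colour class is acyclic (AcyclicityCriterion).  A greedy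
-- choice is possible because each vertex has at most three lower neighbours, except
-- for the vertex coloured last in its block; an extra constraint on a reserved early
-- vertex of an earlier block (ReservedIndices, GreedyColouring) rescues that case.
module Submission where

open import Defs
open import Data.Nat using (ℕ; zero; suc; _+_; _*_; _∸_; _≤_; _<_; z≤n; s≤s; _<?_; NonZero; _/_; _%_)
open import Data.Nat.Properties
open import Data.Nat.DivMod
open import Data.Nat.Tactic.RingSolver using (solve-∀)
open import Data.Fin using (Fin; toℕ)
open import Data.Fin.Properties using (toℕ-injective; toℕ<n)
open import Data.Product using (_×_; _,_; ∃; ∃₂; proj₁; proj₂)
open import Data.Sum using (_⊎_; inj₁; inj₂; [_,_]′; swap)
open import Data.Empty using (⊥; ⊥-elim)
open import Data.Unit using (⊤; tt)
open import Data.List using (List; []; _∷_; _++_; [_]; length; filter; map; upTo; allFin)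
open import Data.List.Properties using (length-++; length-map; length-filter; length-upTo; filter-++; filter-none; map-cong-local)
open import Data.List.Membership.Propositional using (_∈_; _∉_)
open import Data.List.Membership.Propositional.Properties
open import Data.List.Membership.DecPropositional _≟_ using (_∈?_)
open import Data.List.Relation.Unary.Any using (here; there)
open import Data.List.Relation.Unary.All as All using (All; []; _∷_)
open import Data.List.Relation.Unary.AllPairs using ([]; _∷_)
open import Data.List.Relation.Unary.Linked as Linked using (Linked; _∷_)
open import Data.List.Relation.Unary.Unique.Propositional using (Unique)
open import Data.List.Relation.Unary.Unique.Propositional.Properties using (filter⁺; allFin⁺; cartesianProduct⁺; ++⁺)
open import Data.List.Relation.Binary.Disjoint.Propositional using (Disjoint)
open import Relation.Binary.PropositionalEquality hiding ([_])
open import Relation.Binary.Definitions using (tri<; tri≈; tri>)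
open import Relation.Nullary using (¬_; Dec; yes; no)

unique-⊆-length : {A : Set} (xs ys : List A) → Unique xs → (∀ {x} → x ∈ xs → x ∈ ys) →
                  length xs ≤ length ys
unique-⊆-length [] ys _ _ = z≤n
unique-⊆-length (x ∷ xs) ys (x∉xs ∷ xs-unique) xs⊆ys with ∈-∃++ (xs⊆ys (here refl))
... | ys₁ , ys₂ , refl = begin
    suc (length xs)              ≤⟨ s≤s (unique-⊆-length xs (ys₁ ++ ys₂) xs-unique xs⊆ys₁ys₂) ⟩
    suc (length (ys₁ ++ ys₂))    ≡⟨ cong suc (length-++ ys₁) ⟩
    suc (length ys₁ + length ys₂) ≡⟨ sym (+-suc (length ys₁) (length ys₂)) ⟩
    length ys₁ + length (x ∷ ys₂) ≡⟨ sym (length-++ ys₁) ⟩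
    length (ys₁ ++ x ∷ ys₂)      ∎
  where
  open ≤-Reasoning
  xs⊆ys₁ys₂ : ∀ {y} → y ∈ xs → y ∈ ys₁ ++ ys₂
  xs⊆ys₁ys₂ y∈xs with ∈-++⁻ ys₁ (xs⊆ys (there y∈xs))
  ... | inj₁ y∈ys₁        = ∈-++⁺ˡ y∈ys₁
  ... | inj₂ (here refl)  = ⊥-elim (All.lookup x∉xs y∈xs refl)
  ... | inj₂ (there y∈ys₂) = ∈-++⁺ʳ ys₁ y∈ys₂

unique-bounded-length : (M : ℕ) (zs : List ℕ) → Unique zs → (∀ {x} → x ∈ zs → x < M) → length zs ≤ M
unique-bounded-length M zs zs-unique zs<M =
  subst (length zs ≤_) (length-upTo M) (unique-⊆-length zs (upTo M) zs-unique (λ p → ∈-upTo⁺ (zs<M p)))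

constant-length : {A : Set} (xs : List A) → Unique xs → (∀ {x y} → x ∈ xs → y ∈ xs → x ≡ y) → length xs ≤ 1
constant-length []          _                 _ = z≤n
constant-length (x ∷ [])    _                 _ = s≤s z≤n
constant-length (x ∷ y ∷ _) ((x≢y ∷ _) ∷ _) same = ⊥-elim (x≢y (same (here refl) (there (here refl))))

map-unique : {A B : Set} (f : A → B) (xs : List A) → Unique xs →
             (∀ {x y} → x ∈ xs → y ∈ xs → f x ≡ f y → x ≡ y) → Unique (map f xs)
map-unique f []       _              _   = []
map-unique f (x ∷ xs) (x∉xs ∷ xs-unique) inj =
  All.tabulate fx∉ ∷ map-unique f xs xs-unique (λ p q → inj (there p) (there q))
  where
  fx∉ : ∀ {z} → z ∈ map f xs → f x ≢ z
  fx∉ z∈ fx≡z with ∈-map⁻ f z∈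
  ... | y , y∈xs , refl = All.lookup x∉xs y∈xs (inj (here refl) (there y∈xs) fx≡z)

-- The first entry of as that is not in the forbidden list (0 if there is none).
firstFree : List ℕ → List ℕ → ℕ
firstFree []       forb = 0
firstFree (a ∷ as) forb with a ∈? forb
... | yes _ = firstFree as forb
... | no  _ = a

firstFree-spec : ∀ as forb → (∃ λ a → a ∈ as × a ∉ forb) →
                 firstFree as forb ∈ as × firstFree as forb ∉ forb
firstFree-spec []       forb (_ , () , _)
firstFree-spec (a ∷ as) forb (b , b∈ , b∉) with a ∈? forb
... | no a∉ = here refl , a∉
... | yes a∈ with b∈
...   | here refl = ⊥-elim (b∉ a∈)
...   | there b∈as = let (p , q) = firstFree-spec as forb (b , b∈as , b∉) in there p , q

free-or-covered : ∀ as forb → (∃ λ a → a ∈ as × a ∉ forb) ⊎ (∀ {a} → a ∈ as → a ∈ forb)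
free-or-covered []       forb = inj₂ (λ ())
free-or-covered (a ∷ as) forb with a ∈? forb
... | no a∉ = inj₁ (a , here refl , a∉)
... | yes a∈ with free-or-covered as forb
...   | inj₁ (b , b∈ , b∉) = inj₁ (b , there b∈ , b∉)
...   | inj₂ covered = inj₂ (λ { (here refl) → a∈ ; (there p) → covered p })

free-colour : ∀ (k : ℕ) (as forb bound : List ℕ) → Unique as → length as ≡ k →
              (∀ {x} → x ∈ forb → x ∈ bound) → length bound < k → ∃ λ a → a ∈ as × a ∉ forb
free-colour k as forb bound as-unique |as| forb⊆bound bound<k with free-or-covered as forb
... | inj₁ free    = free
... | inj₂ covered =
  ⊥-elim (<⇒≱ bound<k (subst (_≤ length bound) |as|
           (unique-⊆-length as bound as-unique (λ p → forb⊆bound (covered p)))))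

repeated : List ℕ → List ℕ
repeated []       = []
repeated (a ∷ as) with a ∈? as
... | yes _ = a ∷ repeated as
... | no  _ = repeated as

repeated-complete : {V : Set} (c : V → ℕ) (us : List V) {w₁ w₂ : V} → w₁ ≢ w₂ →
                    w₁ ∈ us → w₂ ∈ us → c w₁ ≡ c w₂ → c w₁ ∈ repeated (map c us)
repeated-complete c (u ∷ us) w₁≢w₂ p₁ p₂ c≡ with c u ∈? map c us
repeated-complete c (u ∷ us) w₁≢w₂ (here refl) (here refl) c≡ | _      = ⊥-elim (w₁≢w₂ refl)
repeated-complete c (u ∷ us) w₁≢w₂ (here refl) (there p₂)  c≡ | yes _  = here refl
repeated-complete c (u ∷ us) w₁≢w₂ (here refl) (there p₂)  c≡ | no cu∉ =
  ⊥-elim (cu∉ (subst (_∈ map c us) (sym c≡) (∈-map⁺ c p₂)))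
repeated-complete c (u ∷ us) w₁≢w₂ (there p₁)  (here refl) c≡ | yes _  = here c≡
repeated-complete c (u ∷ us) w₁≢w₂ (there p₁)  (here refl) c≡ | no cu∉ =
  ⊥-elim (cu∉ (subst (_∈ map c us) c≡ (∈-map⁺ c p₁)))
repeated-complete c (u ∷ us) w₁≢w₂ (there p₁)  (there p₂)  c≡ | yes _  =
  there (repeated-complete c us w₁≢w₂ p₁ p₂ c≡)
repeated-complete c (u ∷ us) w₁≢w₂ (there p₁)  (there p₂)  c≡ | no _   =
  repeated-complete c us w₁≢w₂ p₁ p₂ c≡

repeated-singleton : ∀ {x} a → x ∉ repeated [ a ]
repeated-singleton a p with a ∈? []
repeated-singleton a () | no _
repeated-singleton a p  | yes ()

repeated-pair : ∀ {x} a b → x ∈ repeated (a ∷ b ∷ []) → x ≡ a × a ≡ b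
repeated-pair a b p with a ∈? [ b ]
repeated-pair a b p           | no _            = ⊥-elim (repeated-singleton b p)
repeated-pair a b (here refl) | yes (here a≡b)  = refl , a≡b
repeated-pair a b (there p)   | yes _           = ⊥-elim (repeated-singleton b p)

repeated-of-three : ∀ as → length as ≤ 3 →
                    ∃ λ g → length g ≤ 1 × (∀ {x} → x ∈ repeated as → x ∈ g)
repeated-of-three []            _ = [] , z≤n , λ ()
repeated-of-three (a ∷ [])      _ = [] , z≤n , λ p → ⊥-elim (repeated-singleton a p)
repeated-of-three (a ∷ b ∷ [])  _ = [ a ] , s≤s z≤n , λ p → here (proj₁ (repeated-pair a b p))
repeated-of-three (a ∷ b ∷ c ∷ []) _ with a ∈? (b ∷ c ∷ [])
... | no _ = [ b ] , s≤s z≤n , λ p → here (proj₁ (repeated-pair b c p))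
... | yes (here refl) = [ a ] , s≤s z≤n , only-a
  where
  only-a : ∀ {x} → x ∈ a ∷ repeated (a ∷ c ∷ []) → x ∈ [ a ]
  only-a (here refl) = here refl
  only-a (there p)   = here (proj₁ (repeated-pair a c p))
... | yes (there (here refl)) = [ a ] , s≤s z≤n , only-a
  where
  only-a : ∀ {x} → x ∈ a ∷ repeated (b ∷ a ∷ []) → x ∈ [ a ]
  only-a (here refl) = here refl
  only-a (there p)   = let (x≡b , b≡a) = repeated-pair b a p in here (trans x≡b b≡a)
repeated-of-three (_ ∷ _ ∷ _ ∷ _ ∷ _) (s≤s (s≤s (s≤s ())))

repeated-across : {V : Set} (c : V → ℕ) (Y X : List V) {x : ℕ} → length Y ≤ 1 → length X ≤ 1 →
                  x ∈ repeated (map c (Y ++ X)) → ∃₂ λ y x′ → y ∈ Y × x′ ∈ X × c y ≡ c x′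
repeated-across c []          []           _ _ ()
repeated-across c []          (x′ ∷ [])    _ _ p = ⊥-elim (repeated-singleton (c x′) p)
repeated-across c (y ∷ [])    []           _ _ p = ⊥-elim (repeated-singleton (c y) p)
repeated-across c (y ∷ [])    (x′ ∷ [])    _ _ p =
  y , x′ , here refl , here refl , proj₂ (repeated-pair (c y) (c x′) p)
repeated-across c []          (_ ∷ _ ∷ _)  _ (s≤s ()) _
repeated-across c (y ∷ [])    (_ ∷ _ ∷ _)  _ (s≤s ()) _
repeated-across c (_ ∷ _ ∷ _) _            (s≤s ()) _ _

-- Let β : V → ℕ split the vertices into blocks.  If vertices
-- of one block get distinct colours and no vertex has two neighbours in lower blocks
-- sharing its colour, then every colour class is acyclic: along a monochromatic walk
-- that never turns back, β can decrease and then increase but never rise and fall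
-- again, which a closed walk cannot do.
module AcyclicityCriterion (G : Graph) (c β : Vtx G → ℕ)
  (loopless : ∀ {u} → ¬ Adj G u u)
  (block-rainbow : ∀ {u w} → β u ≡ β w → u ≢ w → c u ≢ c w)
  (one-lower-twin : ∀ {u w₁ w₂} → (Adj G u w₁ ⊎ Adj G w₁ u) → (Adj G u w₂ ⊎ Adj G w₂ u) →
                    w₁ ≢ w₂ → β w₁ < β u → β w₂ < β u → c w₁ ≡ c u → c w₂ ≡ c u → ⊥) where

  V : Set
  V = Vtx G

  end penult : V → V → List V → V
  end    x y []       = y
  end    x y (z ∷ zs) = end y z zs
  penult x y []       = x
  penult x y (z ∷ zs) = penult y z zs

  NonBacktracking : List V → Set
  NonBacktracking (x ∷ y ∷ z ∷ zs) = x ≢ z × NonBacktracking (y ∷ z ∷ zs)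
  NonBacktracking _                = ⊤

  module _ (a : ℕ) where

    step-changes-block : ∀ {x y} → Adj G x y → c x ≡ a → c y ≡ a → β x ≡ β y → ⊥
    step-changes-block x~y cx cy βx≡βy =
      block-rainbow βx≡βy (λ { refl → loopless x~y }) (trans cx (sym cy))

    ascending : ∀ x y zs → Linked (Adj G) (x ∷ y ∷ zs) → All (λ v → c v ≡ a) (x ∷ y ∷ zs) →
                NonBacktracking (x ∷ y ∷ zs) → β x < β y →
                β x < β (end x y zs) × β (penult x y zs) < β (end x y zs)
    ascending x y []       _              _               _          βx<βy = βx<βy , βx<βy
    ascending x y (z ∷ zs) (x~y ∷ walk) (cx ∷ cy ∷ cols) (x≢z , nb) βx<βy with <-cmp (β y) (β z)
    ... | tri< βy<βz _ _ =
      let (βy<βend , rise) = ascending y z zs walk (cy ∷ cols) nb βy<βz in <-trans βx<βy βy<βend , rise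
    ... | tri≈ _ βy≡βz _ = ⊥-elim (step-changes-block (Linked.head walk) cy (All.head cols) βy≡βz)
    ... | tri> _ _ βz<βy = ⊥-elim (
      one-lower-twin (inj₂ x~y) (inj₁ (Linked.head walk)) x≢z βx<βy βz<βy
        (trans cx (sym cy)) (trans (All.head cols) (sym cy)))

    descending : ∀ x y zs → Linked (Adj G) (x ∷ y ∷ zs) → All (λ v → c v ≡ a) (x ∷ y ∷ zs) →
                 NonBacktracking (x ∷ y ∷ zs) → β y < β x →
                 β (end x y zs) < β x ⊎ β (penult x y zs) < β (end x y zs)
    descending x y []       _            _               _         βy<βx = inj₁ βy<βx
    descending x y (z ∷ zs) (_ ∷ walk) (_ ∷ cy ∷ cols) (_ , nb) βy<βx with <-cmp (β y) (β z)
    ... | tri< βy<βz _ _ = inj₂ (proj₂ (ascending y z zs walk (cy ∷ cols) nb βy<βz))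
    ... | tri≈ _ βy≡βz _ = ⊥-elim (step-changes-block (Linked.head walk) cy (All.head cols) βy≡βz)
    ... | tri> _ _ βz<βy with descending y z zs walk (cy ∷ cols) nb βz<βy
    ...   | inj₁ βend<βy = inj₁ (<-trans βend<βy βy<βx)
    ...   | inj₂ rise    = inj₂ rise

  end-snoc : ∀ x y zs v → end x y (zs ++ [ v ]) ≡ v
  end-snoc x y []       v = refl
  end-snoc x y (z ∷ zs) v = end-snoc y z zs v

  penult-snoc : ∀ x y zs v → penult x y (zs ++ [ v ]) ≡ end x y zs
  penult-snoc x y []       v = refl
  penult-snoc x y (z ∷ zs) v = penult-snoc y z zs v

  end-∈ : ∀ x y z zs → end x y (z ∷ zs) ∈ z ∷ zs
  end-∈ x y z []        = here refl
  end-∈ x y z (z′ ∷ zs) = there (end-∈ y z z′ zs)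

  last-step : ∀ x y zs → Linked (Adj G) (x ∷ y ∷ zs) → Adj G (penult x y zs) (end x y zs)
  last-step x y []       (x~y ∷ _) = x~y
  last-step x y (z ∷ zs) (_ ∷ walk) = last-step y z zs walk

  closed-nonBacktracking : ∀ x y zs v → Unique (x ∷ y ∷ zs) → All (_≢ v) (x ∷ y ∷ zs) →
                           NonBacktracking (x ∷ y ∷ zs ++ [ v ])
  closed-nonBacktracking x y []       v _                      (x≢v ∷ _) = x≢v , tt
  closed-nonBacktracking x y (z ∷ zs) v ((_ ∷ x≢z ∷ _) ∷ uniq) (_ ∷ ≢v) =
    x≢z , closed-nonBacktracking y z zs v uniq ≢v

  -- If β rises at the start, it rises
  -- to the end and β v < β v; if it falls, it ends below β v or rises into v, so
  -- both cycle neighbours of v lie in lower blocks with v's colour.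
  acyclic : ∀ a → ¬ InducedCycle G (λ v → c v ≡ a)
  acyclic a (v , []           , () , _)
  acyclic a (v , w₁ ∷ []      , s≤s () , _)
  acyclic a (v , w₁ ∷ w₂ ∷ ws , _ , v∉ ∷ rest@(w₁∉ ∷ _) , walk , cv , cws) = impossible
    where
    zs : List V
    zs = w₂ ∷ ws ++ [ v ]
    m : V
    m = end v w₁ (w₂ ∷ ws)
    end≡v : end v w₁ zs ≡ v
    end≡v = end-snoc v w₁ (w₂ ∷ ws) v
    penult≡m : penult v w₁ zs ≡ m
    penult≡m = penult-snoc v w₁ (w₂ ∷ ws) v
    m∈ : m ∈ w₂ ∷ ws
    m∈ = end-∈ v w₁ w₂ ws
    m~v : Adj G m v
    m~v = subst₂ (Adj G) penult≡m end≡v (last-step v w₁ zs walk)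
    colours : All (λ x → c x ≡ a) (v ∷ w₁ ∷ zs)
    colours = cv ∷ All.tabulate (λ p → [ cws , (λ { (here refl) → cv }) ]′ (∈-++⁻ (w₁ ∷ w₂ ∷ ws) p))
    nb : NonBacktracking (v ∷ w₁ ∷ zs)
    nb = All.head (All.tail v∉) , closed-nonBacktracking w₁ w₂ ws v rest (All.map (λ v≢ e → v≢ (sym e)) v∉)
    impossible : ⊥
    impossible with <-cmp (β v) (β w₁)
    ... | tri< βv<βw₁ _ _ =
      <-irrefl (cong β (sym end≡v)) (proj₁ (ascending a v w₁ zs walk colours nb βv<βw₁))
    ... | tri≈ _ βv≡βw₁ _ = block-rainbow βv≡βw₁ (All.head v∉) (trans cv (sym (cws (here refl))))
    ... | tri> _ _ βw₁<βv with descending a v w₁ zs walk colours nb βw₁<βv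
    ...   | inj₁ βend<βv = <-irrefl (cong β end≡v) βend<βv
    ...   | inj₂ rise =
      one-lower-twin (inj₁ (Linked.head walk)) (inj₂ m~v) (All.lookup w₁∉ m∈)
        βw₁<βv (subst₂ (λ p q → β p < β q) penult≡m end≡v rise)
        (trans (cws (here refl)) (sym cv)) (trans (cws (there m∈)) (sym cv))

digits-< : ∀ n i i′ m m′ → i < n → m < m′ → i + m * n < i′ + m′ * n
digits-< n i i′ m m′ i<n m<m′ = begin-strict
    i + m * n   <⟨ +-monoˡ-< (m * n) i<n ⟩
    n + m * n   ≤⟨ *-monoˡ-≤ n m<m′ ⟩
    m′ * n      ≤⟨ m≤n+m (m′ * n) i′ ⟩
    i′ + m′ * n ∎
  where open ≤-Reasoning

digits-≡ : ∀ n i i′ m m′ → i < n → i′ < n → i + m * n ≡ i′ + m′ * n → i ≡ i′ × m ≡ m′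
digits-≡ n i i′ m m′ i<n i′<n eq with <-cmp m m′
... | tri< m<m′ _ _ = ⊥-elim (<-irrefl eq (digits-< n i i′ m m′ i<n m<m′))
... | tri> _ _ m′<m = ⊥-elim (<-irrefl (sym eq) (digits-< n i′ i m′ m i′<n m′<m))
... | tri≈ _ refl _ = +-cancelʳ-≡ (m * n) i i′ eq , refl

digits-<-inv : ∀ n i i′ m m′ → i < n → i′ < n → i + m * n < i′ + m′ * n → m < m′ ⊎ (m ≡ m′ × i < i′)
digits-<-inv n i i′ m m′ i<n i′<n lt with <-cmp m m′
... | tri< m<m′ _ _ = inj₁ m<m′
... | tri≈ _ refl _ = inj₂ (refl , +-cancelʳ-< (m * n) i i′ lt)
... | tri> _ _ m′<m = ⊥-elim (<-asym lt (digits-< n i′ i m′ m i′<n m′<m))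

divmod-unique : ∀ n .{{_ : NonZero n}} p i m → i < n → p ≡ i + m * n → p % n ≡ i × p / n ≡ m
divmod-unique n p i m i<n p≡ =
  digits-≡ n (p % n) i (p / n) m (m%n<n p n) i<n (trans (sym (m≡m%n+[m/n]*n p n)) p≡)

regroup : ∀ i m r q n → i + m * n + (r + q * n) ≡ (i + r) + (m + q) * n
regroup = solve-∀

add-without-carry : ∀ n .{{_ : NonZero n}} d r q → d % n + r < n →
                    (d + (r + q * n)) % n ≡ d % n + r × (d + (r + q * n)) / n ≡ d / n + q
add-without-carry n d r q no-carry = divmod-unique n _ _ _ no-carry (begin
    d + (r + q * n)                   ≡⟨ cong (_+ (r + q * n)) (m≡m%n+[m/n]*n d n) ⟩
    d % n + d / n * n + (r + q * n)   ≡⟨ regroup (d % n) (d / n) r q n ⟩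
    (d % n + r) + (d / n + q) * n     ∎)
  where
  open ≡-Reasoning

add-with-carry : ∀ n .{{_ : NonZero n}} d r q → r < n → n ≤ d % n + r →
                 (d + (r + q * n)) % n ≡ d % n + r ∸ n × (d + (r + q * n)) / n ≡ suc (d / n + q)
add-with-carry n d r q r<n carry = divmod-unique n _ _ _ t<n (begin
    d + (r + q * n)                   ≡⟨ cong (_+ (r + q * n)) (m≡m%n+[m/n]*n d n) ⟩
    d % n + d / n * n + (r + q * n)   ≡⟨ regroup (d % n) (d / n) r q n ⟩
    (d % n + r) + (d / n + q) * n     ≡⟨ cong (_+ (d / n + q) * n) (sym (m∸n+n≡m carry)) ⟩
    (t + n) + (d / n + q) * n         ≡⟨ +-assoc t n ((d / n + q) * n) ⟩
    t + suc (d / n + q) * n           ∎)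
  where
  open ≡-Reasoning
  t : ℕ
  t = d % n + r ∸ n
  t<n : t < n
  t<n = +-cancelʳ-< n t n (subst (_< n + n) (sym (m∸n+n≡m carry)) (+-mono-<-≤ (m%n<n d n) (<⇒≤ r<n)))

parity : ℕ → ℕ
parity zero          = 0
parity (suc zero)    = 1
parity (suc (suc n)) = parity n

parity≤1 : ∀ n → parity n ≤ 1
parity≤1 zero          = z≤n
parity≤1 (suc zero)    = s≤s z≤n
parity≤1 (suc (suc n)) = parity≤1 n

parity-suc : ∀ n → parity (suc n) ≢ parity n
parity-suc zero          ()
parity-suc (suc zero)    ()
parity-suc (suc (suc n)) eq = parity-suc n eq

-- Cut the positions 0, 1, 2, … into blocks of k = j + 3 consecutive positions; position
-- p has block p / k and index p % k.  In block b the index late b will be coloured last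
-- and early b first.  They are chosen, depending on n₃ = r + q * k, so that they differ
-- and the position n₃ below a late position is early.
module ReservedIndices (j n₃ : ℕ) (n₃-pos : 1 ≤ n₃) where

  k : ℕ
  k = suc (suc (suc j))

  -- If k divides n₃ the two
  -- reserved indices alternate between 1 and 2 every q blocks; otherwise late is 1 and
  -- early is the index 1 - r modulo k.  (The case n₃ = 0 does not occur.)
  late′ early′ : ℕ → ℕ → ℕ → ℕ
  late′ zero    (suc q) b = suc (parity (b / suc q))
  late′ zero    zero    b = 1
  late′ (suc r) q       b = 1
  early′ zero          (suc q) b = suc (parity (suc (b / suc q)))
  early′ zero          zero    b = 0
  early′ (suc zero)    q       b = 0
  early′ (suc (suc r)) q       b = k ∸ suc r

  late early : ℕ → ℕ
  late  = late′ (n₃ % k) (n₃ / k)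
  early = early′ (n₃ % k) (n₃ / k)

  late≥1 : ∀ b → 1 ≤ late b
  late≥1 b with n₃ % k | n₃ / k
  ... | zero  | suc q = s≤s z≤n
  ... | zero  | zero  = s≤s z≤n
  ... | suc r | q     = s≤s z≤n

  late<k : ∀ b → late b < k
  late<k b with n₃ % k | n₃ / k
  ... | zero  | suc q = s≤s (s≤s (≤-trans (parity≤1 (b / suc q)) (s≤s z≤n)))
  ... | zero  | zero  = s≤s (s≤s z≤n)
  ... | suc r | q     = s≤s (s≤s z≤n)

  -- The two reserved indices of a block differ (for r = 0 by parity, else by r < k).
  early≢late′ : ∀ r q b → r < k → early′ r q b ≢ late′ r q b
  early≢late′ zero          (suc q) b _ eq = parity-suc (b / suc q) (suc-injective eq)
  early≢late′ zero          zero    b _ ()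
  early≢late′ (suc zero)    q       b _ ()
  early≢late′ (suc (suc r)) q       b (s≤s (s≤s (s≤s r≤j))) eq =
    1+n≢0 (+-cancelˡ-≡ 1 _ _ (trans (sym (+-∸-assoc 2 r≤j)) eq))

  early≢late : ∀ b → early b ≢ late b
  early≢late b = early≢late′ (n₃ % k) (n₃ / k) b (m%n<n n₃ k)

  -- Adding n₃ = r + q * k to d shifts its index by r, with or without carry, and its
  -- block by q or q + 1; by cases on r this turns a late index into an early one.
  below-late-is-early′ : ∀ r q → r < k → n₃ ≡ r + q * k → ∀ d →
                         (d + n₃) % k ≡ late′ r q ((d + n₃) / k) → d % k ≡ early′ r q (d / k)
  below-late-is-early′ zero zero _ n₃≡ d _ = ⊥-elim (1+n≰n (subst (1 ≤_) n₃≡ n₃-pos))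
  below-late-is-early′ zero (suc q) _ refl d late-at = begin
    d % k                                   ≡⟨ +-identityʳ (d % k) ⟨
    d % k + 0                               ≡⟨ proj₁ shift ⟨
    (d + n₃) % k                            ≡⟨ late-at ⟩
    suc (parity ((d + n₃) / k / suc q))     ≡⟨ cong (λ b → suc (parity (b / suc q))) (proj₂ shift) ⟩
    suc (parity ((d / k + suc q) / suc q))  ≡⟨ cong (λ b → suc (parity b)) next-group ⟩
    suc (parity (suc (d / k / suc q)))      ∎
    where
    open ≡-Reasoning
    shift : (d + n₃) % k ≡ d % k + 0 × (d + n₃) / k ≡ d / k + suc q
    shift = add-without-carry k d 0 (suc q) (subst (_< k) (sym (+-identityʳ (d % k))) (m%n<n d k))
    -- Moving up q + 1 blocks moves to the next group of q + 1 blocks.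
    next-group : (d / k + suc q) / suc q ≡ suc (d / k / suc q)
    next-group = trans (m/n≡1+[m∸n]/n (m≤n+m (suc q) (d / k)))
                       (cong (λ b → suc (b / suc q)) (m+n∸n≡m (d / k) (suc q)))
  below-late-is-early′ (suc r) q r<k refl d late-at with d % k + suc r <? k
  ... | yes no-carry = index-one r (trans (sym (proj₁ (add-without-carry k d (suc r) q no-carry))) late-at)
    where
    -- Without a carry the late index 1 is d % k + r + 1, forcing r = 0 and d % k = 0.
    index-one : ∀ r → d % k + suc r ≡ 1 → d % k ≡ early′ (suc r) q (d / k)
    index-one zero     eq = +-cancelʳ-≡ 1 (d % k) 0 eq
    index-one (suc r′) eq = ⊥-elim (1+n≰n (subst (2 ≤_) eq (subst (2 ≤_) (+-comm (suc (suc r′)) (d % k)) (s≤s (s≤s z≤n)))))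
  ... | no carry = index-wrapped r (trans (sym (m∸n+n≡m carry′)) (cong (_+ k) wrapped))
    where
    carry′ : k ≤ d % k + suc r
    carry′ = ≮⇒≥ carry
    wrapped : d % k + suc r ∸ k ≡ 1
    wrapped = trans (sym (proj₁ (add-with-carry k d (suc r) q r<k carry′))) late-at
    -- With a carry d % k + r + 1 = k + 1, so d % k = k - r, which is early unless r = 0.
    index-wrapped : ∀ r → d % k + suc r ≡ suc k → d % k ≡ early′ (suc r) q (d / k)
    index-wrapped zero     eq =
      ⊥-elim (<-irrefl (+-cancelʳ-≡ 1 (d % k) k (trans eq (+-comm 1 k))) (m%n<n d k))
    index-wrapped (suc r′) eq = begin
      d % k                                  ≡⟨ m+n∸n≡m (d % k) (suc (suc r′)) ⟨
      d % k + suc (suc r′) ∸ suc (suc r′)    ≡⟨ cong (_∸ suc (suc r′)) eq ⟩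
      k ∸ suc r′                             ∎
      where open ≡-Reasoning

  -- The position n₃ below a late position (one step down in the second coordinate
  -- of the grid) is early.
  below-late-is-early : ∀ d → (d + n₃) % k ≡ late ((d + n₃) / k) → d % k ≡ early (d / k)
  below-late-is-early = below-late-is-early′ (n₃ % k) (n₃ / k) (m%n<n n₃ k) (m≡m%n+[m/n]*n n₃ k)

-- Vertex (a, b, z) gets position
-- a * (n₂ * n₃) + b * n₃ + z, a bijection onto 0, …, N - 1.  Each vertex has at most
-- three lower neighbours (one coordinate decreased by one), at positions 1, n₃ and
-- n₂ * n₃ below it; every edge joins a vertex to one of its lower neighbours.
module GridOrder (n₁ n₂ n₃ : ℕ) where

  V : Set
  V = Vtx (Grid n₁ n₂ n₃)

  A N : ℕ
  A = n₂ * n₃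
  N = n₁ * n₂ * n₃

  inner< : ∀ (b : Fin n₂) (z : Fin n₃) → toℕ b * n₃ + toℕ z < A
  inner< b z = begin-strict
      toℕ b * n₃ + toℕ z  <⟨ +-monoʳ-< (toℕ b * n₃) (toℕ<n z) ⟩
      toℕ b * n₃ + n₃     ≡⟨ +-comm (toℕ b * n₃) n₃ ⟩
      suc (toℕ b) * n₃    ≤⟨ *-monoˡ-≤ n₃ (toℕ<n b) ⟩
      A                   ∎
    where open ≤-Reasoning

  opaque
    pos : V → ℕ
    pos ((a , b) , z) = toℕ a * A + (toℕ b * n₃ + toℕ z)

    pos<N : ∀ v → pos v < N
    pos<N ((a , b) , z) = begin-strict
        toℕ a * A + (toℕ b * n₃ + toℕ z)  <⟨ +-monoʳ-< (toℕ a * A) (inner< b z) ⟩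
        toℕ a * A + A                     ≡⟨ +-comm (toℕ a * A) A ⟩
        suc (toℕ a) * A                   ≤⟨ *-monoˡ-≤ A (toℕ<n a) ⟩
        n₁ * A                            ≡⟨ *-assoc n₁ n₂ n₃ ⟨
        N                                 ∎
      where open ≤-Reasoning

    -- Positions are mixed-radix numerals, so equal positions have equal digits.
    pos-injective : ∀ {v w} → pos v ≡ pos w → v ≡ w
    pos-injective {(a , b) , z} {(a′ , b′) , z′} eq
      with digits-≡ A (toℕ b * n₃ + toℕ z) (toℕ b′ * n₃ + toℕ z′) (toℕ a) (toℕ a′) (inner< b z) (inner< b′ z′)
             (trans (+-comm _ (toℕ a * A)) (trans eq (+-comm (toℕ a′ * A) _)))
    ... | inner≡ , a≡ with digits-≡ n₃ (toℕ z) (toℕ z′) (toℕ b) (toℕ b′) (toℕ<n z) (toℕ<n z′)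
             (trans (+-comm (toℕ z) (toℕ b * n₃)) (trans inner≡ (+-comm (toℕ b′ * n₃) (toℕ z′))))
    ...   | z≡ , b≡ with toℕ-injective a≡ | toℕ-injective b≡ | toℕ-injective z≡
    ...     | refl | refl | refl = refl

  n₃≥1 : V → 1 ≤ n₃
  n₃≥1 (_ , z) = ≤-trans (s≤s z≤n) (toℕ<n z)

  A≥1 : V → 1 ≤ A
  A≥1 ((_ , b) , z) = ≤-trans (s≤s z≤n) (inner< b z)

  predecessor : ∀ {n} → Fin n → List (Fin n)
  predecessor {n} i = filter (λ i′ → suc (toℕ i′) ≟ toℕ i) (allFin n)

  predecessor-sound : ∀ {n} {i i′ : Fin n} → i′ ∈ predecessor i → suc (toℕ i′) ≡ toℕ i
  predecessor-sound {n} {i} p = proj₂ (∈-filter⁻ (λ i′ → suc (toℕ i′) ≟ toℕ i) {xs = allFin n} p)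

  predecessor-complete : ∀ {n} {i i′ : Fin n} → suc (toℕ i′) ≡ toℕ i → i′ ∈ predecessor i
  predecessor-complete {i = i} {i′} = ∈-filter⁺ (λ i′ → suc (toℕ i′) ≟ toℕ i) (∈-allFin i′)

  predecessor-length : ∀ {n} (i : Fin n) → length (predecessor i) ≤ 1
  predecessor-length {n} i =
    constant-length (predecessor i) (filter⁺ (λ i′ → suc (toℕ i′) ≟ toℕ i) (allFin⁺ n))
      (λ p q → toℕ-injective (suc-injective (trans (predecessor-sound p) (sym (predecessor-sound q)))))

  lowerZ lowerY lowerX lower : V → List V
  lowerZ ((a , b) , z) = map (λ z′ → (a , b) , z′) (predecessor z)
  lowerY ((a , b) , z) = map (λ b′ → (a , b′) , z) (predecessor b)
  lowerX ((a , b) , z) = map (λ a′ → (a′ , b) , z) (predecessor a)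
  lower v = lowerZ v ++ lowerY v ++ lowerX v

  map-predecessor-length : ∀ {n} {B : Set} (f : Fin n → B) (i : Fin n) → length (map f (predecessor i)) ≤ 1
  map-predecessor-length f i = subst (_≤ 1) (sym (length-map f (predecessor i))) (predecessor-length i)

  lowerZ-length : ∀ v → length (lowerZ v) ≤ 1
  lowerZ-length ((a , b) , z) = map-predecessor-length _ z

  lowerY-length : ∀ v → length (lowerY v) ≤ 1
  lowerY-length ((a , b) , z) = map-predecessor-length _ b

  lowerX-length : ∀ v → length (lowerX v) ≤ 1
  lowerX-length ((a , b) , z) = map-predecessor-length _ a

  lower-length : ∀ v → length (lower v) ≤ 3
  lower-length v = begin
      length (lowerZ v ++ lowerY v ++ lowerX v)                    ≡⟨ length-++ (lowerZ v) ⟩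
      length (lowerZ v) + length (lowerY v ++ lowerX v)            ≡⟨ cong (length (lowerZ v) +_) (length-++ (lowerY v)) ⟩
      length (lowerZ v) + (length (lowerY v) + length (lowerX v))  ≤⟨ +-mono-≤ (lowerZ-length v)
                                                                        (+-mono-≤ (lowerY-length v) (lowerX-length v)) ⟩
      3                                                            ∎
    where open ≤-Reasoning

  opaque
    unfolding pos

    lowerZ-pos : ∀ {v w} → w ∈ lowerZ v → pos w + 1 ≡ pos v
    lowerZ-pos {(a , b) , z} p with ∈-map⁻ _ p
    ... | z′ , z′∈ , refl rewrite sym (predecessor-sound z′∈) = shift (toℕ a * A) (toℕ b * n₃) (toℕ z′)
      where
      shift : ∀ x y z → x + (y + z) + 1 ≡ x + (y + suc z)
      shift = solve-∀

    lowerY-pos : ∀ {v w} → w ∈ lowerY v → pos w + n₃ ≡ pos v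
    lowerY-pos {(a , b) , z} p with ∈-map⁻ _ p
    ... | b′ , b′∈ , refl rewrite sym (predecessor-sound b′∈) = shift (toℕ a * A) (toℕ b′) (toℕ z) n₃
      where
      shift : ∀ x y z n → x + (y * n + z) + n ≡ x + (suc y * n + z)
      shift = solve-∀

    lowerX-pos : ∀ {v w} → w ∈ lowerX v → pos w + A ≡ pos v
    lowerX-pos {(a , b) , z} p with ∈-map⁻ _ p
    ... | a′ , a′∈ , refl rewrite sym (predecessor-sound a′∈) = shift (toℕ a′) (toℕ b * n₃ + toℕ z) A
      where
      shift : ∀ x r a → x * a + r + a ≡ suc x * a + r
      shift = solve-∀

  lower-pos : ∀ {v w} → w ∈ lower v → pos w < pos v
  lower-pos {v} {w} p with ∈-++⁻ (lowerZ v) p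
  ... | inj₁ q = subst (pos w <_) (trans (+-comm 1 (pos w)) (lowerZ-pos q)) ≤-refl
  ... | inj₂ q with ∈-++⁻ (lowerY v) q
  ...   | inj₁ r = subst (pos w <_) (lowerY-pos r) (m<m+n (pos w) (n₃≥1 v))
  ...   | inj₂ r = subst (pos w <_) (lowerX-pos r) (m<m+n (pos w) (A≥1 v))

  vertices : List V
  vertices = gridVertices n₁ n₂ n₃

  vertices-complete : ∀ v → v ∈ vertices
  vertices-complete ((a , b) , z) =
    ∈-cartesianProduct⁺ (∈-cartesianProduct⁺ (∈-allFin a) (∈-allFin b)) (∈-allFin z)

  vertices-unique : Unique vertices
  vertices-unique = cartesianProduct⁺ (cartesianProduct⁺ (allFin⁺ n₁) (allFin⁺ n₂)) (allFin⁺ n₃)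

  edge-lower : ∀ {v w} → Adj (Grid n₁ n₂ n₃) v w → w ∈ lower v ⊎ v ∈ lower w
  edge-lower (inj₁ (inj₁ (inj₁ a′≡1+a , refl) , refl)) =
    inj₂ (∈-++⁺ʳ (lowerZ _) (∈-++⁺ʳ (lowerY _) (∈-map⁺ _ (predecessor-complete (sym a′≡1+a)))))
  edge-lower (inj₁ (inj₁ (inj₂ a≡1+a′ , refl) , refl)) =
    inj₁ (∈-++⁺ʳ (lowerZ _) (∈-++⁺ʳ (lowerY _) (∈-map⁺ _ (predecessor-complete (sym a≡1+a′)))))
  edge-lower (inj₁ (inj₂ (refl , inj₁ b′≡1+b) , refl)) =
    inj₂ (∈-++⁺ʳ (lowerZ _) (∈-++⁺ˡ (∈-map⁺ _ (predecessor-complete (sym b′≡1+b)))))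
  edge-lower (inj₁ (inj₂ (refl , inj₂ b≡1+b′) , refl)) =
    inj₁ (∈-++⁺ʳ (lowerZ _) (∈-++⁺ˡ (∈-map⁺ _ (predecessor-complete (sym b≡1+b′)))))
  edge-lower (inj₂ (refl , inj₁ z′≡1+z)) = inj₂ (∈-++⁺ˡ (∈-map⁺ _ (predecessor-complete (sym z′≡1+z))))
  edge-lower (inj₂ (refl , inj₂ z≡1+z′)) = inj₁ (∈-++⁺ˡ (∈-map⁺ _ (predecessor-complete (sym z≡1+z′))))

  loopless : ∀ {v} → ¬ Adj (Grid n₁ n₂ n₃) v v
  loopless v~v with edge-lower v~v
  ... | inj₁ p = <-irrefl refl (lower-pos p)
  ... | inj₂ p = <-irrefl refl (lower-pos p)

  -- A lower y-neighbour exists only if n₂ ≥ 2, and then n₃ < n₂ * n₃: the lower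
  -- x-neighbour of a vertex precedes its lower y-neighbour.
  lowerX<lowerY : ∀ {u y x} → y ∈ lowerY u → x ∈ lowerX u → pos x < pos y
  lowerX<lowerY {u@((a , b) , z)} {y} {x} y∈ x∈ =
    +-cancelʳ-< n₃ (pos x) (pos y)
      (subst (pos x + n₃ <_) (trans (lowerX-pos x∈) (sym (lowerY-pos y∈))) (+-monoʳ-< (pos x) n₃<A))
    where
    n₂≥2 : 2 ≤ n₂
    n₂≥2 with ∈-map⁻ _ y∈
    ... | b′ , b′∈ , refl = ≤-trans (s≤s (s≤s z≤n)) (subst (_≤ n₂) (cong suc (sym (predecessor-sound b′∈))) (toℕ<n b))
    n₃<A : n₃ < A
    n₃<A = begin-strict
        n₃          <⟨ m<m+n n₃ (n₃≥1 u) ⟩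
        n₃ + n₃     ≡⟨ cong (n₃ +_) (+-identityʳ n₃) ⟨
        2 * n₃      ≤⟨ *-monoˡ-≤ n₃ n₂≥2 ⟩
        A           ∎
      where open ≤-Reasoning

-- Blocks are processed in increasing order; inside a block the early
-- vertex comes first, the late vertex last, and the others in between by index.
module Blocks (n₁ n₂ n₃ j : ℕ) (n₃-pos : 1 ≤ n₃) where
  open GridOrder n₁ n₂ n₃ public
  open ReservedIndices j n₃ n₃-pos public

  opaque
    block index : V → ℕ
    block v = pos v / k
    index v = pos v % k

    block-def : ∀ v → block v ≡ pos v / k
    block-def v = refl

    index-def : ∀ v → index v ≡ pos v % k
    index-def v = refl

    index<k : ∀ v → index v < k
    index<k v = m%n<n (pos v) k

    pos≡ : ∀ v → pos v ≡ index v + block v * k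
    pos≡ v = m≡m%n+[m/n]*n (pos v) k

    block-mono : ∀ {w v} → pos w ≤ pos v → block w ≤ block v
    block-mono pos≤ = /-monoˡ-≤ k pos≤

  block-index-injective : ∀ {w u} → block w ≡ block u → index w ≡ index u → w ≡ u
  block-index-injective {w} {u} b≡ i≡ =
    pos-injective (trans (pos≡ w) (trans (cong₂ (λ i b → i + b * k) i≡ b≡) (sym (pos≡ u))))

  block<⌈N/k⌉ : ∀ v → block v < ⌈ N / k ⌉
  block<⌈N/k⌉ v = ≤-trans (≤-reflexive (sym next-block)) (/-monoˡ-≤ k pos+k≤)
    where
    next-block : (pos v + k) / k ≡ suc (block v)
    next-block = proj₂ (divmod-unique k (pos v + k) (index v) (suc (block v)) (index<k v)
                   (trans (cong (_+ k) (pos≡ v)) (trans (+-assoc (index v) (block v * k) k)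
                     (cong (index v +_) (+-comm (block v * k) k)))))
    pos+k≤ : pos v + k ≤ N + suc (suc j)
    pos+k≤ = subst (_≤ N + suc (suc j)) (sym (+-suc (pos v) (suc (suc j))))
               (+-monoˡ-≤ (suc (suc j)) (pos<N v))

  lower-block-neighbour : ∀ {u w} → (Adj (Grid n₁ n₂ n₃) u w ⊎ Adj (Grid n₁ n₂ n₃) w u) →
                          block w < block u → w ∈ lower u
  lower-block-neighbour {u} {w} u~w βw<βu with [ edge-lower , (λ w~u → swap (edge-lower w~u)) ]′ u~w
  ... | inj₁ w∈ = w∈
  ... | inj₂ u∈ = ⊥-elim (<⇒≱ βw<βu (block-mono (<⇒≤ (lower-pos u∈))))

  -- The position n₃ below a vertex is its lower y-neighbour, so that neighbour of a
  -- late vertex is early.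
  lowerY-of-late : ∀ {u y} → y ∈ lowerY u → index u ≡ late (block u) → index y ≡ early (block y)
  lowerY-of-late {u} {y} y∈ u-late = begin
      index y             ≡⟨ index-def y ⟩
      pos y % k           ≡⟨ below-late-is-early (pos y) y-late ⟩
      early (pos y / k)   ≡⟨ cong early (block-def y) ⟨
      early (block y)     ∎
    where
    open ≡-Reasoning
    y-late : (pos y + n₃) % k ≡ late ((pos y + n₃) / k)
    y-late = subst (λ p → p % k ≡ late (p / k)) (sym (lowerY-pos y∈))
               (trans (sym (index-def u)) (trans u-late (cong late (block-def u))))

  lowerZ-same-block : ∀ u → 1 ≤ index u → ∀ {w} → w ∈ lowerZ u → block w ≡ block u
  lowerZ-same-block u index≥1 {w} w∈ =
    trans (block-def w) (proj₂ (divmod-unique k (pos w) (index u ∸ 1) (block u) i-1<k pos-w≡))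
    where
    index≡ : index u ≡ suc (index u ∸ 1)
    index≡ = sym (m+[n∸m]≡n index≥1)
    i-1<k : index u ∸ 1 < k
    i-1<k = <-trans (n<1+n (index u ∸ 1)) (subst (_< k) index≡ (index<k u))
    pos-w≡ : pos w ≡ index u ∸ 1 + block u * k
    pos-w≡ = suc-injective (trans (+-comm 1 (pos w))
               (trans (lowerZ-pos w∈) (trans (pos≡ u) (cong (_+ block u * k) index≡))))

  tier′ : ℕ → ℕ → ℕ → ℕ
  tier′ i e l with i ≟ e
  ... | yes _ = 0
  ... | no  _ with i ≟ l
  ...   | yes _ = 2
  ...   | no  _ = 1

  data TierView (i e l : ℕ) : ℕ → Set where
    early-tier  : i ≡ e → TierView i e l 0
    middle-tier : i ≢ e → i ≢ l → TierView i e l 1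
    late-tier   : i ≢ e → i ≡ l → TierView i e l 2

  tier-view′ : ∀ i e l → TierView i e l (tier′ i e l)
  tier-view′ i e l with i ≟ e
  ... | yes i≡e = early-tier i≡e
  ... | no  i≢e with i ≟ l
  ...   | yes i≡l = late-tier i≢e i≡l
  ...   | no  i≢l = middle-tier i≢e i≢l

  tier : V → ℕ
  tier v = tier′ (index v) (early (block v)) (late (block v))

  tier-view : ∀ v → TierView (index v) (early (block v)) (late (block v)) (tier v)
  tier-view v = tier-view′ (index v) (early (block v)) (late (block v))

  module _ {i e l : ℕ} where
    view≤2 : ∀ {t} → TierView i e l t → t ≤ 2
    view≤2 (early-tier _)    = z≤n
    view≤2 (middle-tier _ _) = s≤s z≤n
    view≤2 (late-tier _ _)   = ≤-refl

    view-0 : ∀ {t} → TierView i e l t → t ≡ 0 → i ≡ e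
    view-0 (early-tier i≡e) _ = i≡e

    view-1 : ∀ {t} → TierView i e l t → t ≡ 1 → i ≢ l
    view-1 (middle-tier _ i≢l) _ = i≢l

    view-early : ∀ {t} → TierView i e l t → i ≡ e → t ≡ 0
    view-early (early-tier _)      _   = refl
    view-early (middle-tier i≢e _) i≡e = ⊥-elim (i≢e i≡e)
    view-early (late-tier i≢e _)   i≡e = ⊥-elim (i≢e i≡e)

    view-middle : ∀ {t} → TierView i e l t → i ≢ e → i ≢ l → t ≡ 1
    view-middle (early-tier i≡e)  i≢e _   = ⊥-elim (i≢e i≡e)
    view-middle (middle-tier _ _) _   _   = refl
    view-middle (late-tier _ i≡l) _   i≢l = ⊥-elim (i≢l i≡l)

  rank : V → ℕ
  rank v = index v + (block v * 3 + tier v) * k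

  -- Tiers are at most 2, so a lower block means a smaller rank.
  rank-block : ∀ {w u} → block w < block u → rank w < rank u
  rank-block {w} {u} βw<βu =
    digits-< k (index w) (index u) (block w * 3 + tier w) (block u * 3 + tier u) (index<k w) (begin-strict
      block w * 3 + tier w   ≤⟨ +-monoʳ-≤ (block w * 3) (view≤2 (tier-view w)) ⟩
      block w * 3 + 2        <⟨ +-monoʳ-< (block w * 3) ≤-refl ⟩
      block w * 3 + 3        ≡⟨ +-comm (block w * 3) 3 ⟩
      suc (block w) * 3      ≤⟨ *-monoˡ-≤ 3 βw<βu ⟩
      block u * 3            ≤⟨ m≤m+n (block u * 3) (tier u) ⟩
      block u * 3 + tier u   ∎)
    where open ≤-Reasoning

  rank-injective : ∀ {w u} → block w ≡ block u → rank w ≡ rank u → w ≡ u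
  rank-injective {w} {u} β≡ rank≡ =
    block-index-injective β≡ (proj₁ (digits-≡ k (index w) (index u) (block w * 3 + tier w) (block u * 3 + tier u)
                                               (index<k w) (index<k u) rank≡))

  rank-in-block : ∀ {w u} → block w ≡ block u → rank w < rank u →
                  tier w < tier u ⊎ (tier w ≡ tier u × index w < index u)
  rank-in-block {w} {u} β≡ rank<
    with digits-<-inv k (index w) (index u) (block w * 3 + tier w) (block u * 3 + tier u) (index<k w) (index<k u) rank<
  ... | inj₁ outer< = inj₁ (+-cancelˡ-< (block u * 3) (tier w) (tier u)
                             (subst (λ b → b * 3 + tier w < block u * 3 + tier u) β≡ outer<))
  ... | inj₂ (outer≡ , index<) = inj₂ (+-cancelˡ-≡ (block u * 3) (tier w) (tier u)
                             (subst (λ b → b * 3 + tier w ≡ block u * 3 + tier u) β≡ outer≡) , index<)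

-- Vertices are coloured in rank order; vertex u takes the
-- first colour of L u not forbidden, where the forbidden colours are
--   * the colours of the vertices before u in its block,
--   * the colours repeated among u's lower neighbours in lower blocks, and
--   * for an early u, the colour of its diagonal vertex: the lower x-neighbour of
--     its upper y-neighbour, which sits n₂ * n₃ - n₃ positions below u.
-- The first rule makes blocks rainbow, the second leaves u at most one lower
-- neighbour of its colour, and the third is what keeps late vertices feasible.
module GreedyColouring (n₁ n₂ n₃ j : ℕ) (n₃-pos : 1 ≤ n₃) (L : Vtx (Grid n₁ n₂ n₃) → List ℕ)
                       (L-uniform : IsUniformListAssignment (suc (suc (suc j))) L) where
  open Blocks n₁ n₂ n₃ j n₃-pos public

  sameBlock diagonalBelow : V → List V
  sameBlock u    = filter (λ w → block w ≟ block u) vertices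
  diagonalBelow u = filter (λ w → pos w + A ≟ pos u + n₃) vertices

  before lowerOut diagonal : V → List V
  before u   = filter (λ w → rank w <? rank u) (sameBlock u)
  lowerOut u = filter (λ w → block w <? block u) (lower u)
  diagonal u with index u ≟ early (block u)
  ... | yes _ = filter (λ w → block w <? block u) (diagonalBelow u)
  ... | no  _ = []

  before-rank : ∀ {u w} → w ∈ before u → rank w < rank u
  before-rank {u} p = proj₂ (∈-filter⁻ (λ w → rank w <? rank u) {xs = sameBlock u} p)

  before-block : ∀ {u w} → w ∈ before u → block w ≡ block u
  before-block {u} p = proj₂ (∈-filter⁻ (λ w → block w ≟ block u) {xs = vertices}
                              (proj₁ (∈-filter⁻ (λ w → rank w <? rank u) {xs = sameBlock u} p)))

  before-complete : ∀ {w u} → block w ≡ block u → rank w < rank u → w ∈ before u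
  before-complete {w} {u} β≡ rank< =
    ∈-filter⁺ (λ w → rank w <? rank u) (∈-filter⁺ (λ w → block w ≟ block u) (vertices-complete w) β≡) rank<

  before-indices-unique : ∀ u → Unique (map index (before u))
  before-indices-unique u =
    map-unique index (before u) (filter⁺ (λ w → rank w <? rank u) (filter⁺ (λ w → block w ≟ block u) vertices-unique))
      (λ p q → block-index-injective (trans (before-block p) (sym (before-block q))))

  lowerOut-block : ∀ {u w} → w ∈ lowerOut u → block w < block u
  lowerOut-block {u} p = proj₂ (∈-filter⁻ (λ w → block w <? block u) {xs = lower u} p)

  lowerOut-complete : ∀ {u w} → w ∈ lower u → block w < block u → w ∈ lowerOut u
  lowerOut-complete {u} = ∈-filter⁺ (λ w → block w <? block u)

  lowerOut-length : ∀ u → length (lowerOut u) ≤ 3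
  lowerOut-length u = ≤-trans (length-filter (λ w → block w <? block u) (lower u)) (lower-length u)

  diagonal-block : ∀ {u w} → w ∈ diagonal u → block w < block u
  diagonal-block {u} p with index u ≟ early (block u)
  ... | yes _ = proj₂ (∈-filter⁻ (λ w → block w <? block u) {xs = diagonalBelow u} p)

  diagonal-only-early : ∀ {u w} → w ∈ diagonal u → index u ≡ early (block u)
  diagonal-only-early {u} p with index u ≟ early (block u)
  ... | yes early-u = early-u

  diagonal-complete : ∀ {u w} → index u ≡ early (block u) → pos w + A ≡ pos u + n₃ → block w < block u →
                      w ∈ diagonal u
  diagonal-complete {u} {w} early-u pos≡ β< with index u ≟ early (block u)
  ... | yes _       = ∈-filter⁺ (λ w → block w <? block u)
                        (∈-filter⁺ (λ w → pos w + A ≟ pos u + n₃) (vertices-complete w) pos≡) β<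
  ... | no  ¬early  = ⊥-elim (¬early early-u)

  diagonal-length : ∀ u → length (diagonal u) ≤ 1
  diagonal-length u with index u ≟ early (block u)
  ... | no  _ = z≤n
  ... | yes _ = ≤-trans (length-filter (λ w → block w <? block u) (diagonalBelow u))
                  (constant-length (diagonalBelow u) (filter⁺ (λ w → pos w + A ≟ pos u + n₃) vertices-unique) same)
    where
    same : ∀ {x y} → x ∈ diagonalBelow u → y ∈ diagonalBelow u → x ≡ y
    same {x} {y} p q = pos-injective (+-cancelʳ-≡ A (pos x) (pos y)
      (trans (proj₂ (∈-filter⁻ (λ w → pos w + A ≟ pos u + n₃) {xs = vertices} p))
             (sym (proj₂ (∈-filter⁻ (λ w → pos w + A ≟ pos u + n₃) {xs = vertices} q)))))

  opaque
    forbidden : (V → ℕ) → V → List ℕ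
    forbidden c u = map c (before u) ++ repeated (map c (lowerOut u)) ++ map c (diagonal u)

    forbidden-local : ∀ (f g : V → ℕ) u → (∀ w → rank w < rank u → f w ≡ g w) → forbidden f u ≡ forbidden g u
    forbidden-local f g u agree =
      cong₂ _++_ (map-agree (λ p → before-rank p))
        (cong₂ _++_ (cong repeated (map-agree (λ p → rank-block (lowerOut-block p))))
                    (map-agree (λ p → rank-block (diagonal-block p))))
      where
      map-agree : ∀ {xs} → (∀ {w} → w ∈ xs → rank w < rank u) → map f xs ≡ map g xs
      map-agree below = map-cong-local (All.tabulate (λ p → agree _ (below p)))

    forbidden-before : ∀ c {u w} → w ∈ before u → c w ∈ forbidden c u
    forbidden-before c p = ∈-++⁺ˡ (∈-map⁺ c p)

    forbidden-repeated : ∀ c {u x} → x ∈ repeated (map c (lowerOut u)) → x ∈ forbidden c u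
    forbidden-repeated c {u} p = ∈-++⁺ʳ (map c (before u)) (∈-++⁺ˡ p)

    forbidden-diagonal : ∀ c {u w} → w ∈ diagonal u → c w ∈ forbidden c u
    forbidden-diagonal c {u} p =
      ∈-++⁺ʳ (map c (before u)) (∈-++⁺ʳ (repeated (map c (lowerOut u))) (∈-map⁺ c p))

    forbidden-cases : ∀ c u {x} → x ∈ forbidden c u →
                      x ∈ map c (before u) ⊎ x ∈ repeated (map c (lowerOut u)) ⊎ x ∈ map c (diagonal u)
    forbidden-cases c u p with ∈-++⁻ (map c (before u)) p
    ... | inj₁ q = inj₁ q
    ... | inj₂ q = inj₂ (∈-++⁻ (repeated (map c (lowerOut u))) q)

  opaque
    -- The greedy colouring computed with fuel n, which suffices for vertices of rank below n.
    colourWithin : ℕ → V → ℕ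
    colourWithin zero    v = 0
    colourWithin (suc n) v = firstFree (L v) (forbidden (colourWithin n) v)

    colourWithin-stable : ∀ m n w → rank w < m → rank w < n → colourWithin m w ≡ colourWithin n w
    colourWithin-stable (suc m) (suc n) w (s≤s rank≤m) (s≤s rank≤n) =
      cong (firstFree (L w)) (forbidden-local (colourWithin m) (colourWithin n) w
        (λ w′ rank′< → colourWithin-stable m n w′ (<-≤-trans rank′< rank≤m) (<-≤-trans rank′< rank≤n)))

    colour : V → ℕ
    colour v = colourWithin (suc (rank v)) v

    colour-greedy : ∀ u → colour u ≡ firstFree (L u) (forbidden colour u)
    colour-greedy u = cong (firstFree (L u)) (forbidden-local (colourWithin (rank u)) colour u
      (λ w rank< → colourWithin-stable (rank u) (suc (rank w)) w rank< ≤-refl))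

  Feasible : V → Set
  Feasible u = ∃ λ a → a ∈ L u × a ∉ forbidden colour u

  colour-feasible : ∀ u → Feasible u → colour u ∈ L u × colour u ∉ forbidden colour u
  colour-feasible u feasible = subst (λ a → a ∈ L u × a ∉ forbidden colour u) (sym (colour-greedy u))
                                 (firstFree-spec (L u) (forbidden colour u) feasible)

  rainbow : ∀ {w u} → Feasible w → Feasible u → block w ≡ block u → w ≢ u → colour w ≢ colour u
  rainbow {w} {u} fw fu β≡ w≢u c≡ with <-cmp (rank w) (rank u)
  ... | tri< w<u _ _ = proj₂ (colour-feasible u fu) (subst (_∈ forbidden colour u) c≡
                         (forbidden-before colour (before-complete β≡ w<u)))
  ... | tri≈ _ rank≡ _ = w≢u (rank-injective β≡ rank≡)
  ... | tri> _ _ u<w = proj₂ (colour-feasible w fw) (subst (_∈ forbidden colour w) (sym c≡)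
                         (forbidden-before colour (before-complete (sym β≡) u<w)))

  feasible-if-few : ∀ u (bound : List ℕ) → (∀ {x} → x ∈ forbidden colour u → x ∈ bound) → length bound < k →
                    Feasible u
  feasible-if-few u bound = free-colour k (L u) (forbidden colour u) bound (proj₁ (L-uniform u)) (proj₂ (L-uniform u))

  before-index≢ : ∀ {u w} → w ∈ before u → index w ≢ index u
  before-index≢ p index≡ = <-irrefl (cong rank (block-index-injective (before-block p) index≡)) (before-rank p)

  few-before : ∀ u (avoid : List ℕ) → Unique (index u ∷ avoid) → (∀ {i} → i ∈ avoid → i < k) →
               (∀ {w} → w ∈ before u → index w ∉ avoid) → length avoid + length (before u) < k
  few-before u avoid uniq avoid<k before∉ =
    subst (_≤ k) count≡ (unique-bounded-length k indices (++⁺ uniq (before-indices-unique u) disjoint) bounded)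
    where
    indices : List ℕ
    indices = (index u ∷ avoid) ++ map index (before u)
    count≡ : length indices ≡ suc (length avoid + length (before u))
    count≡ = trans (length-++ (index u ∷ avoid)) (cong (λ n → suc (length avoid + n)) (length-map index (before u)))
    disjoint : Disjoint (index u ∷ avoid) (map index (before u))
    disjoint (p , q) with ∈-map⁻ index q
    disjoint (here refl , _) | w , w∈ , eq   = before-index≢ w∈ (sym eq)
    disjoint (there p , _)   | w , w∈ , refl = before∉ w∈ p
    bounded : ∀ {i} → i ∈ indices → i < k
    bounded p with ∈-++⁻ (index u ∷ avoid) p
    ... | inj₁ (here refl) = index<k u
    ... | inj₁ (there q)   = avoid<k q
    ... | inj₂ q with ∈-map⁻ index q
    ...   | w , _ , refl = index<k w

  repeated-cover : ∀ u → ∃ λ g → length g ≤ 1 × (∀ {x} → x ∈ repeated (map colour (lowerOut u)) → x ∈ g)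
  repeated-cover u = repeated-of-three (map colour (lowerOut u))
                       (subst (_≤ 3) (sym (length-map colour (lowerOut u))) (lowerOut-length u))

  -- An early vertex is first in its block: at most one repeated colour and one
  -- diagonal colour are forbidden, and k ≥ 3.
  feasible-early : ∀ u → index u ≡ early (block u) → Feasible u
  feasible-early u early-u = feasible-if-few u (cover ++ map colour (diagonal u)) covered few
    where
    cover : List ℕ
    cover = proj₁ (repeated-cover u)
    tier-u≡0 : tier u ≡ 0
    tier-u≡0 = view-early (tier-view u) early-u
    nothing-before : ∀ {w} → w ∉ before u
    nothing-before {w} p with rank-in-block (before-block p) (before-rank p)
    ... | inj₁ tier< = n≮0 (subst (tier w <_) tier-u≡0 tier<)
    ... | inj₂ (tier≡ , _) =
      before-index≢ p (trans (view-0 (tier-view w) (trans tier≡ tier-u≡0)) (trans (cong early (before-block p)) (sym early-u)))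
    covered : ∀ {x} → x ∈ forbidden colour u → x ∈ cover ++ map colour (diagonal u)
    covered p with forbidden-cases colour u p
    ... | inj₁ q with ∈-map⁻ colour q
    ...   | w , w∈ , _ = ⊥-elim (nothing-before w∈)
    covered p | inj₂ (inj₁ q) = ∈-++⁺ˡ (proj₂ (proj₂ (repeated-cover u)) q)
    covered p | inj₂ (inj₂ q) = ∈-++⁺ʳ cover q
    few : length (cover ++ map colour (diagonal u)) < k
    few = subst (_< k) (sym (length-++ cover))
            (≤-trans (s≤s (+-mono-≤ (proj₁ (proj₂ (repeated-cover u)))
                                    (subst (_≤ 1) (sym (length-map colour (diagonal u))) (diagonal-length u))))
                     (s≤s (s≤s (s≤s z≤n))))

  -- A middle vertex is preceded in its block only by vertices avoiding its own index
  -- and the late index, so with one repeated colour a free colour remains.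
  feasible-middle : ∀ u → index u ≢ early (block u) → index u ≢ late (block u) → Feasible u
  feasible-middle u ¬early ¬late = feasible-if-few u (map colour (before u) ++ cover) covered few
    where
    cover : List ℕ
    cover = proj₁ (repeated-cover u)
    tier-u≡1 : tier u ≡ 1
    tier-u≡1 = view-middle (tier-view u) ¬early ¬late
    before-not-late : ∀ {w} → w ∈ before u → index w ∉ [ late (block u) ]
    before-not-late {w} p (here index≡late) with rank-in-block (before-block p) (before-rank p)
    ... | inj₁ tier< = early≢late (block u) (trans (sym early-w) index≡late)
      where
      early-w : index w ≡ early (block u)
      early-w = trans (view-0 (tier-view w) (n<1⇒n≡0 (subst (tier w <_) tier-u≡1 tier<))) (cong early (before-block p))
    ... | inj₂ (tier≡ , _) =
      view-1 (tier-view w) (trans tier≡ tier-u≡1) (trans index≡late (cong late (sym (before-block p))))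
    covered : ∀ {x} → x ∈ forbidden colour u → x ∈ map colour (before u) ++ cover
    covered p with forbidden-cases colour u p
    ... | inj₁ q = ∈-++⁺ˡ q
    ... | inj₂ (inj₁ q) = ∈-++⁺ʳ (map colour (before u)) (proj₂ (proj₂ (repeated-cover u)) q)
    ... | inj₂ (inj₂ q) with ∈-map⁻ colour q
    ...   | w , w∈ , _ = ⊥-elim (¬early (diagonal-only-early w∈))
    few : length (map colour (before u) ++ cover) < k
    few = begin-strict
        length (map colour (before u) ++ cover)    ≡⟨ length-++ (map colour (before u)) ⟩
        length (map colour (before u)) + length cover
          ≤⟨ +-mono-≤ (≤-reflexive (length-map colour (before u))) (proj₁ (proj₂ (repeated-cover u))) ⟩
        length (before u) + 1                      ≡⟨ +-comm (length (before u)) 1 ⟩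
        1 + length (before u)                      <⟨ few-before u [ late (block u) ] ((¬late ∷ []) ∷ [] ∷ [])
                                                        (λ { (here refl) → late<k (block u) }) before-not-late ⟩
        k                                          ∎
      where open ≤-Reasoning

  -- Let u be late and all vertices of lower blocks feasible.  Then no colour repeats
  -- among u's lower-block neighbours: its lower z-neighbour is in its own block, and
  -- its lower x-neighbour x precedes its lower y-neighbour y.  If x and y share a
  -- block they differ by the rainbow property; otherwise y is early with diagonal x.
  late-no-repeat : ∀ u → index u ≡ late (block u) → (∀ w → block w < block u → Feasible w) →
                   ∀ {c} → c ∉ repeated (map colour (lowerOut u))
  late-no-repeat u late-u lower-feasible rep = impossible
    where
    P? : ∀ w → Dec (block w < block u)
    P? w = block w <? block u
    lowerOut≡ : lowerOut u ≡ filter P? (lowerY u) ++ filter P? (lowerX u)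
    lowerOut≡ = begin
        filter P? (lowerZ u ++ lowerY u ++ lowerX u)                 ≡⟨ filter-++ P? (lowerZ u) (lowerY u ++ lowerX u) ⟩
        filter P? (lowerZ u) ++ filter P? (lowerY u ++ lowerX u)     ≡⟨ cong (_++ filter P? (lowerY u ++ lowerX u)) no-lowerZ ⟩
        filter P? (lowerY u ++ lowerX u)                             ≡⟨ filter-++ P? (lowerY u) (lowerX u) ⟩
        filter P? (lowerY u) ++ filter P? (lowerX u)                 ∎
      where
      open ≡-Reasoning
      no-lowerZ : filter P? (lowerZ u) ≡ []
      no-lowerZ = filter-none P? (All.tabulate (λ w∈ β< →
        <-irrefl (lowerZ-same-block u (subst (1 ≤_) (sym late-u) (late≥1 (block u))) w∈) β<))
    distinct-colours : ∀ {y x} → y ∈ lowerY u → x ∈ lowerX u → block y < block u → block x < block u →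
                       colour y ≢ colour x
    distinct-colours {y} {x} y∈ x∈ βy<βu βx<βu c≡ with <-cmp (block x) (block y)
    ... | tri< βx<βy _ _ = proj₂ (colour-feasible y (lower-feasible y βy<βu))
                             (subst (_∈ forbidden colour y) (sym c≡) (forbidden-diagonal colour x-diagonal))
      where
      x-diagonal : x ∈ diagonal y
      x-diagonal = diagonal-complete (lowerY-of-late y∈ late-u) (trans (lowerX-pos x∈) (sym (lowerY-pos y∈))) βx<βy
    ... | tri≈ _ β≡ _ = rainbow (lower-feasible x βx<βu) (lower-feasible y βy<βu) β≡
                          (λ { refl → <-irrefl refl (lowerX<lowerY y∈ x∈) }) (sym c≡)
    ... | tri> _ _ βy<βx = <⇒≱ βy<βx (block-mono (<⇒≤ (lowerX<lowerY y∈ x∈)))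
    impossible : ⊥
    impossible
      with repeated-across colour (filter P? (lowerY u)) (filter P? (lowerX u))
             (≤-trans (length-filter P? (lowerY u)) (lowerY-length u))
             (≤-trans (length-filter P? (lowerX u)) (lowerX-length u))
             (subst (λ ws → _ ∈ repeated (map colour ws)) lowerOut≡ rep)
    ... | y , x , y∈ , x∈ , c≡ with ∈-filter⁻ P? {xs = lowerY u} y∈ | ∈-filter⁻ P? {xs = lowerX u} x∈
    ...   | y∈Y , βy<βu | x∈X , βx<βu = distinct-colours y∈Y x∈X βy<βu βx<βu c≡

  -- A late vertex is last in its block, and by late-no-repeat only the colours before
  -- it are forbidden.
  feasible-late : ∀ u → index u ≡ late (block u) → (∀ w → block w < block u → Feasible w) → Feasible u
  feasible-late u late-u lower-feasible = feasible-if-few u (map colour (before u)) covered few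
    where
    covered : ∀ {x} → x ∈ forbidden colour u → x ∈ map colour (before u)
    covered p with forbidden-cases colour u p
    ... | inj₁ q = q
    ... | inj₂ (inj₁ q) = ⊥-elim (late-no-repeat u late-u lower-feasible q)
    ... | inj₂ (inj₂ q) with ∈-map⁻ colour q
    ...   | w , w∈ , _ = ⊥-elim (early≢late (block u) (trans (sym (diagonal-only-early w∈)) late-u))
    few : length (map colour (before u)) < k
    few = subst (_< k) (sym (length-map colour (before u))) (few-before u [] ([] ∷ []) (λ ()) (λ _ ()))

  feasible : ∀ u → Feasible u
  feasible u = by-block (suc (block u)) u ≤-refl
    where
    by-block : ∀ n u → block u < n → Feasible u
    by-block (suc n) u (s≤s β≤n) = by-kind (index u ≟ early (block u)) (index u ≟ late (block u))
      where
      by-kind : Dec (index u ≡ early (block u)) → Dec (index u ≡ late (block u)) → Feasible u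
      by-kind (yes early-u) _            = feasible-early u early-u
      by-kind (no ¬early)   (no ¬late)   = feasible-middle u ¬early ¬late
      by-kind (no _)        (yes late-u) = feasible-late u late-u (λ w β< → by-block n w (<-≤-trans β< β≤n))

  colour-in-list : ∀ v → colour v ∈ L v
  colour-in-list v = proj₁ (colour-feasible v (feasible v))

  block-rainbow : ∀ {u w} → block u ≡ block w → u ≢ w → colour u ≢ colour w
  block-rainbow = rainbow (feasible _) (feasible _)

  one-lower-twin : ∀ {u w₁ w₂} → (Adj (Grid n₁ n₂ n₃) u w₁ ⊎ Adj (Grid n₁ n₂ n₃) w₁ u) →
                   (Adj (Grid n₁ n₂ n₃) u w₂ ⊎ Adj (Grid n₁ n₂ n₃) w₂ u) → w₁ ≢ w₂ →
                   block w₁ < block u → block w₂ < block u → colour w₁ ≡ colour u → colour w₂ ≡ colour u → ⊥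
  one-lower-twin {u} {w₁} {w₂} u~w₁ u~w₂ w₁≢w₂ β₁< β₂< c₁≡ c₂≡ =
    proj₂ (colour-feasible u (feasible u)) (subst (_∈ forbidden colour u) c₁≡
      (forbidden-repeated colour (repeated-complete colour (lowerOut u) w₁≢w₂
        (lowerOut-complete (lower-block-neighbour u~w₁ β₁<) β₁<)
        (lowerOut-complete (lower-block-neighbour u~w₂ β₂<) β₂<) (trans c₁≡ (sym c₂≡)))))

  open AcyclicityCriterion (Grid n₁ n₂ n₃) colour block loopless block-rainbow one-lower-twin public
    using (acyclic)

  -- A colour class meets every block at most once, and there are at most ⌈ N / k ⌉ blocks.
  class-bound : ∀ a → classSize n₁ n₂ n₃ colour a ≤ ⌈ N / k ⌉
  class-bound a = subst (_≤ ⌈ N / k ⌉) (length-map block colourClass)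
    (unique-bounded-length ⌈ N / k ⌉ (map block colourClass)
      (map-unique block colourClass (filter⁺ (λ v → colour v ≟ a) vertices-unique) one-per-block)
      bounded)
    where
    colourClass : List V
    colourClass = filter (λ v → colour v ≟ a) vertices
    coloured-a : ∀ {v} → v ∈ colourClass → colour v ≡ a
    coloured-a p = proj₂ (∈-filter⁻ (λ v → colour v ≟ a) {xs = vertices} p)
    one-per-block : ∀ {x y} → x ∈ colourClass → y ∈ colourClass → block x ≡ block y → x ≡ y
    one-per-block {x} {y} p q β≡ with rank x ≟ rank y
    ... | yes rank≡ = rank-injective β≡ rank≡
    ... | no  rank≢ = ⊥-elim (block-rainbow β≡ (λ x≡y → rank≢ (cong rank x≡y)) (trans (coloured-a p) (sym (coloured-a q))))
    bounded : ∀ {b} → b ∈ map block colourClass → b < ⌈ N / k ⌉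
    bounded q with ∈-map⁻ block q
    ... | v , _ , refl = block<⌈N/k⌉ v

theorem9 : (n₁ n₂ n₃ k : ℕ) → 1 ≤ n₁ → 1 ≤ n₂ → 1 ≤ n₃ → 3 ≤ k →
           EquitablyListArborableGrid n₁ n₂ n₃ k
theorem9 n₁ n₂ n₃ (suc (suc (suc j))) _ _ n₃-pos _ L L-uniform =
  colour , colour-in-list , class-bound , acyclic
  where open GreedyColouring n₁ n₂ n₃ j n₃-pos L L-uniform
theorem9 _ _ _ (suc zero)       _ _ _ (s≤s ())
theorem9 _ _ _ (suc (suc zero)) _ _ _ (s≤s (s≤s ()))
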